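{- Let $\{m_I\mid I\in\Sigma\}$ be a monotone monomial family in $\mathbb{K}[x_1,\dots,x_n]$ and, for each $I\in\Sigma$, let $p_I$ be an $I$-deformation of $m_I$. Then there is a direct sum decomposition of vector spaces $$\mathbb{K}[x_1,\dots,x_n]=\langle R\rangle\oplus\bigoplus_{I\in\Sigma}p_I\,\mathbb{K}[x_I]\,\langle R_I\rangle.$$
   Context: $\mathbb{K}$ is a field, $\Sigma$ a set of nonempty subsets of $\{1,\dots,n\}$. Monotone monomial family: (MM1) $m_I$ involves only $x_i$, $i\in I$; (MM2) $\deg_{x_i}m_I\ge\deg_{x_i}m_J$ whenever $I\subset J$ in $\Sigma$, $i\in I$; (MM3) for $I,J\in\Sigma$ some $K\in\Sigma$, $K\supseteq I\cup J$, has $m_K\mid\mathrm{lcm}(m_I,m_J)$. For $I=\{i_1,\dots,i_r\}$, $\mathbb{K}[x_I]=\mathbb{K}[x_{i_1},\dots,x_{i_r}]$; an $I$-deformation of a monomial $m\in\mathbb{K}[x_I]$ is a homogeneous $p\in\mathbb{K}[x_I]$ of degree $\deg m$ with $\mathbb{K}[x_I]=\langle R_m\rangle\oplus(p)$, $\langle R_m\rangle$ the span of monomials of $\mathbb{K}[x_I]$ not divisible by $m$ and $(p)$ the ideal of $\mathbb{K}[x_I]$ generated by $p$. $R$ is the set of monomials in $\mathbb{K}[x_1,\dots,x_n]$ not divisible by any $m_I$, $I\in\Sigma$. For $I\in\Sigma$ let $\overline I=\{1,\dots,n\}\setminus I$, $\mathfrak{M}_{\overline I}$ the set of monomials in the variables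 $x_i$, $i\in\overline I$; for $J\in\Sigma$, $m_{J/I}$ is the monomial obtained from $m_J$ by deleting all $x_i$ with $i\in I$, and $M_{J/I}=m_{J/I}\cdot\mathfrak{M}_{\overline I}$. Then $R_I=\mathfrak{M}_{\overline I}\setminus\bigcup_{J\in\Sigma,\,J\supsetneq I}M_{J/I}$. $\langle\cdot\rangle$ denotes linear span, and $p_I\,\mathbb{K}[x_I]\,\langle R_I\rangle$ is the span of products $p_I\,f\,r$ with $f\in\mathbb{K}[x_I]$, $r\in R_I$. -}

module Defs where

open import Level using (_⊔_; suc)
open import Algebra.Bundles using (CommutativeRing)
open import Data.Nat as ℕ using (ℕ; _≤_; _⊔_)
open import Data.Fin using (Fin)
open import Data.Fin.Subset using (Subset; _∈_; _∉_; _⊆_; _⊂_; _∪_; ∁; Nonempty)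
open import Data.Vec using (Vec; lookup; zipWith; toList)
open import Data.Vec.Properties using (≡-dec)
open import Data.List using (List; []; _∷_; _++_; map; concatMap; foldr)
open import Data.List.Membership.Propositional using () renaming (_∈_ to _∈ₗ_)
open import Data.List.Relation.Unary.All using (All)
open import Data.List.Relation.Unary.Unique.Propositional using (Unique)
open import Data.Product using (Σ; ∃; ∃-syntax; _×_; _,_)
open import Relation.Nullary using (¬_; yes; no)
open import Relation.Binary.PropositionalEquality using (_≡_)

record Field c ℓ : Set (Level.suc (c Level.⊔ ℓ)) where
  field
    commutativeRing : CommutativeRing c ℓ
  open CommutativeRing commutativeRing public
  field
    1≉0 : ¬ (1# ≈ 0#)
    inverse : ∀ x → ¬ (x ≈ 0#) → ∃[ y ] (x * y ≈ 1#)

Mon : ℕ → Set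
Mon n = Vec ℕ n

_·ₘ_ : ∀ {n} → Mon n → Mon n → Mon n
u ·ₘ v = zipWith ℕ._+_ u v

_∣ₘ_ : ∀ {n} → Mon n → Mon n → Set
u ∣ₘ v = ∀ i → lookup u i ≤ lookup v i

lcmₘ : ∀ {n} → Mon n → Mon n → Mon n
lcmₘ u v = zipWith ℕ._⊔_ u v

degₘ : ∀ {n} → Mon n → ℕ
degₘ u = foldr ℕ._+_ 0 (toList u)

SupportedIn : ∀ {n} → Subset n → Mon n → Set
SupportedIn I u = ∀ i → i ∉ I → lookup u i ≡ 0

delete : ∀ {n} → Subset n → Mon n → Mon n
delete I u = zipWith (λ b e → Data.Bool.if b then 0 else e) I u
  where import Data.Bool

-- Monotone monomial families (MM1)-(MM3); Σ is a duplicate-free list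
-- of nonempty subsets, m is the family (only its values on Σ matter).

record MonotoneFamily (n : ℕ) (Σs : List (Subset n)) (m : Subset n → Mon n) : Set where
  field
    MM1 : ∀ {I} → I ∈ₗ Σs → SupportedIn I (m I)
    MM2 : ∀ {I J} → I ∈ₗ Σs → J ∈ₗ Σs → I ⊆ J →
          ∀ i → i ∈ I → lookup (m J) i ≤ lookup (m I) i
    MM3 : ∀ {I J} → I ∈ₗ Σs → J ∈ₗ Σs →
          ∃[ K ] (K ∈ₗ Σs × (I ∪ J) ⊆ K × m K ∣ₘ lcmₘ (m I) (m J))

-- Polynomials over a field, as formal finite sums of terms, compared by
-- their coefficient functions.

module Polynomials {c ℓ} (F : Field c ℓ) (n : ℕ) where
  open Field F

  Poly : Set c
  Poly = List (Carrier × Mon n)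

  coeff : Poly → Mon n → Carrier
  coeff [] u = 0#
  coeff ((a , v) ∷ f) u with ≡-dec ℕ._≟_ v u
  ... | yes _ = a + coeff f u
  ... | no _  = coeff f u

  infix 4 _≈ₚ_
  _≈ₚ_ : Poly → Poly → Set ℓ
  f ≈ₚ g = ∀ u → coeff f u ≈ coeff g u

  0ₚ : Poly
  0ₚ = []

  infixl 6 _+ₚ_
  _+ₚ_ : Poly → Poly → Poly
  f +ₚ g = f ++ g

  infixl 7 _*ₚ_
  _*ₚ_ : Poly → Poly → Poly
  f *ₚ g = concatMap (λ { (a , u) → map (λ { (b , v) → (a * b , u ·ₘ v) }) g }) f

  sumₚ : List Poly → Poly
  sumₚ = foldr _+ₚ_ 0ₚ

  InSpan : (Mon n → Set) → Poly → Set ℓ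
  InSpan S f = ∀ u → ¬ S u → coeff f u ≈ 0#

  InVars : Subset n → Poly → Set ℓ
  InVars I = InSpan (SupportedIn I)

  Homogeneous : ℕ → Poly → Set ℓ
  Homogeneous d p = ∀ u → ¬ (degₘ u ≡ d) → coeff p u ≈ 0#

  InRm : Subset n → Mon n → Poly → Set ℓ
  InRm I m = InSpan (λ u → SupportedIn I u × ¬ (m ∣ₘ u))

  -- p is an I-deformation of the monomial m ∈ 𝕂[x_I]:
  -- 𝕂[x_I] = ⟨R_m⟩ ⊕ (p), (p) the ideal of 𝕂[x_I] generated by p.
  record IDeformation (I : Subset n) (m : Mon n) (p : Poly) : Set (c Level.⊔ ℓ) where
    field
      inVars      : InVars I p
      homogeneous : Homogeneous (degₘ m) p
      spanning    : ∀ f → InVars I f →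
                    ∃[ r ] ∃[ q ] (InRm I m r × InVars I q × f ≈ₚ r +ₚ p *ₚ q)
      independent : ∀ r q → InRm I m r → InVars I q →
                    r +ₚ p *ₚ q ≈ₚ 0ₚ → (r ≈ₚ 0ₚ × p *ₚ q ≈ₚ 0ₚ)

  module _ (Σs : List (Subset n)) (m : Subset n → Mon n) where

    InR : Mon n → Set
    InR u = ∀ I → I ∈ₗ Σs → ¬ (m I ∣ₘ u)

    InM : Subset n → Subset n → Mon n → Set
    InM J I v = ∃[ w ] (SupportedIn (∁ I) w × v ≡ delete I (m J) ·ₘ w)

    InRI : Subset n → Mon n → Set
    InRI I v = SupportedIn (∁ I) v × (∀ J → J ∈ₗ Σs → I ⊂ J → ¬ InM J I v)

    InKR : Subset n → Poly → Set ℓ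
    InKR I = InSpan (λ w → ∃[ u ] ∃[ v ] (SupportedIn I u × InRI I v × w ≡ u ·ₘ v))

-- Every monomial w lies in R or has a largest I ∈ Σ with m_I ∣ w, since by (MM3) these I are
-- closed under joins; for this leading I the Ī-part of w lies in R_I.
--
-- Spanning: for a term a·w whose Ī-part v lies in R_I, write a·w_I = r + p_I·q with
-- r ∈ ⟨R_{m_I}⟩ and q ∈ 𝕂[x_I]. Then a·w = r·v + p_I·(q·v), where q·v ∈ 𝕂[x_I]⟨R_I⟩ and every
-- monomial of r·v lies in R or has leading index J ⊊ I, so induction along ⊊ finishes.
--
-- Directness: the I-summand only involves monomials whose Ī-part lies in R_I. In a vanishing sum
-- whose summands for all J ⊋ I are already known to vanish, p_I g_I therefore has zero coefficient
-- at every monomial with leading index I, hence at every multiple of m_I. Grouping its monomials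
-- by their Ī-part and using the independence of p_I in 𝕂[x_I] gives p_I g_I = 0; downward
-- induction along ⊊ then kills every summand, and with them r.

module Submission where

open import Defs
open import Data.Nat using (ℕ)
open import Data.Fin.Subset using (Subset; Nonempty)
open import Data.List using (List; map)
open import Data.List.Membership.Propositional using (_∈_)
open import Data.List.Relation.Unary.All using (All)
open import Data.List.Relation.Unary.Unique.Propositional using (Unique)
open import Data.Product using (Σ; ∃-syntax; _×_)

open import Level using (_⊔_)
open import Data.Bool using (true; false; if_then_else_)
import Data.Bool.Properties as Bool
open import Data.Empty using (⊥-elim)
open import Data.Fin using (Fin)
open import Data.Fin.Subset as Sub using (_⊆_; _⊂_; ∁)
open import Data.Fin.Subset.Properties using (_∈?_; _⊂?_; ⊆-antisym; p⊆p∪q; q⊆p∪q; x∉∁p⇒x∈p; x∈p⇒x∉∁p)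
open import Data.Fin.Subset.Induction using (⊂-wellFounded; ⊃-wellFounded)
import Data.Fin.Properties as Fin
open import Data.List using ([]; _∷_; _++_; length; filter)
import Data.List.Properties as List
open import Data.List.Membership.Propositional using (find; lose)
open import Data.List.Relation.Unary.All as All using ([]; _∷_)
open import Data.List.Relation.Unary.All.Properties using (all-filter)
open import Data.List.Relation.Unary.Any using (here; there; any?)
open import Data.List.Relation.Unary.AllPairs using ([]; _∷_)
import Data.Nat as ℕ
import Data.Nat.Properties as ℕ
open import Data.Product using (_,_; proj₁; proj₂)
open import Data.Sum using (_⊎_; inj₁; inj₂; [_,_]′)
open import Data.Vec using (lookup; zipWith)
open import Data.Vec.Properties using (lookup-zipWith; zipWith-assoc; []=⇒lookup; lookup⇒[]=)
import Data.Vec.Properties as Vec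
open import Data.Vec.Relation.Binary.Pointwise.Extensional using (ext; Pointwise-≡⇒≡)
open import Function using (_∘_)
import Induction.WellFounded as WF
open import Relation.Nullary using (¬_; Dec; yes; no)
open import Relation.Unary using (Decidable)
open import Relation.Binary.Bundles using (Setoid)
import Relation.Binary.Reasoning.Setoid as SetoidReasoning
import Algebra.Properties.Ring as RingProperties
import Algebra.Properties.CommutativeSemigroup as CommutativeSemigroupProperties
open import Relation.Nullary.Decidable using (¬?; _×-dec_; _→-dec_)
open import Relation.Binary.PropositionalEquality as ≡ using (_≡_; _≢_; refl; cong; subst)

module _ {n : ℕ} where

  Mon-ext : {u v : Mon n} → (∀ i → lookup u i ≡ lookup v i) → u ≡ v
  Mon-ext = Pointwise-≡⇒≡ ∘ ext

  keep : Subset n → Mon n → Mon n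
  keep I u = zipWith (λ b e → if b then e else 0) I u

  lookup-·ₘ : ∀ (u v : Mon n) i → lookup (u ·ₘ v) i ≡ lookup u i ℕ.+ lookup v i
  lookup-·ₘ u v i = lookup-zipWith ℕ._+_ i u v

  lookup-lcmₘ : ∀ (u v : Mon n) i → lookup (lcmₘ u v) i ≡ lookup u i ℕ.⊔ lookup v i
  lookup-lcmₘ u v i = lookup-zipWith ℕ._⊔_ i u v

  lookup-delete : ∀ I (u : Mon n) i → lookup (delete I u) i ≡ (if lookup I i then 0 else lookup u i)
  lookup-delete I u i = lookup-zipWith _ i I u

  lookup-keep : ∀ I (u : Mon n) i → lookup (keep I u) i ≡ (if lookup I i then lookup u i else 0)
  lookup-keep I u i = lookup-zipWith _ i I u

  data Membership (I : Subset n) (i : Fin n) : Set where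
    inside  : i Sub.∈ I → lookup I i ≡ true → Membership I i
    outside : i Sub.∉ I → lookup I i ≡ false → Membership I i

  membership : ∀ I i → Membership I i
  membership I i with i ∈? I
  ... | yes i∈I = inside i∈I ([]=⇒lookup i∈I)
  ... | no i∉I = outside i∉I (Bool.¬-not (i∉I ∘ lookup⇒[]= i I))

  supportedIn? : ∀ I (u : Mon n) → Dec (SupportedIn I u)
  supportedIn? I u = Fin.all? (λ i → ¬? (i ∈? I) →-dec (lookup u i ℕ.≟ 0))

  _∣ₘ?_ : ∀ (u v : Mon n) → Dec (u ∣ₘ v)
  u ∣ₘ? v = Fin.all? (λ i → lookup u i ℕ.≤? lookup v i)

  ∣ₘ-lcmₘ⇒∣ₘ : ∀ (x u v w : Mon n) → x ∣ₘ lcmₘ u v → u ∣ₘ w → v ∣ₘ w → x ∣ₘ w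
  ∣ₘ-lcmₘ⇒∣ₘ x u v w x∣lcm u∣w v∣w i =
    ℕ.≤-trans (x∣lcm i) (subst (ℕ._≤ _) (≡.sym (lookup-lcmₘ u v i)) (ℕ.⊔-lub (u∣w i) (v∣w i)))

  ∣ₘ-·ₘ : ∀ (u v : Mon n) → u ∣ₘ (u ·ₘ v)
  ∣ₘ-·ₘ u v i rewrite lookup-·ₘ u v i = ℕ.m≤m+n _ _

  ·ₘ-supported : ∀ {I} (u v : Mon n) → SupportedIn I u → SupportedIn I v → SupportedIn I (u ·ₘ v)
  ·ₘ-supported u v u∈I v∈I i i∉I rewrite lookup-·ₘ u v i | u∈I i i∉I | v∈I i i∉I = refl

  ·ₘ-assoc : ∀ (u v w : Mon n) → (u ·ₘ v) ·ₘ w ≡ u ·ₘ (v ·ₘ w)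
  ·ₘ-assoc = zipWith-assoc ℕ.+-assoc

  ·ₘ-cancelʳ : ∀ (u v w : Mon n) → u ·ₘ w ≡ v ·ₘ w → u ≡ v
  ·ₘ-cancelʳ u v w eq = Mon-ext λ i → ℕ.+-cancelʳ-≡ (lookup w i) _ _ (begin
    lookup u i ℕ.+ lookup w i ≡⟨ ≡.sym (lookup-·ₘ u w i) ⟩
    lookup (u ·ₘ w) i         ≡⟨ cong (λ z → lookup z i) eq ⟩
    lookup (v ·ₘ w) i         ≡⟨ lookup-·ₘ v w i ⟩
    lookup v i ℕ.+ lookup w i ∎)
    where open ≡.≡-Reasoning

  keep-·ₘ-delete : ∀ I (w : Mon n) → keep I w ·ₘ delete I w ≡ w
  keep-·ₘ-delete I w = Mon-ext λ i → ≡.trans (lookup-·ₘ (keep I w) (delete I w) i) (pointwise i)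
    where
    pointwise : ∀ i → lookup (keep I w) i ℕ.+ lookup (delete I w) i ≡ lookup w i
    pointwise i rewrite lookup-keep I w i | lookup-delete I w i with lookup I i
    ... | true  = ℕ.+-identityʳ _
    ... | false = refl

  keep-supported : ∀ I (w : Mon n) → SupportedIn I (keep I w)
  keep-supported I w i i∉I with membership I i
  ... | inside i∈I _ = ⊥-elim (i∉I i∈I)
  ... | outside _ eq rewrite lookup-keep I w i | eq = refl

  delete-supported : ∀ I (w : Mon n) → SupportedIn (∁ I) (delete I w)
  delete-supported I w i i∉∁I rewrite lookup-delete I w i | []=⇒lookup (x∉∁p⇒x∈p i∉∁I) = refl

  delete-·ₘ-supported : ∀ {I} (u w : Mon n) → SupportedIn I u → delete I (u ·ₘ w) ≡ delete I w
  delete-·ₘ-supported {I} u w u∈I = Mon-ext pointwise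
    where
    pointwise : ∀ i → lookup (delete I (u ·ₘ w)) i ≡ lookup (delete I w) i
    pointwise i rewrite lookup-delete I (u ·ₘ w) i | lookup-delete I w i | lookup-·ₘ u w i
      with membership I i
    ... | inside _ eq rewrite eq = refl
    ... | outside i∉I eq rewrite eq | u∈I i i∉I = refl

  delete-supported-∁ : ∀ {I} (v : Mon n) → SupportedIn (∁ I) v → delete I v ≡ v
  delete-supported-∁ {I} v v∈∁I = Mon-ext pointwise
    where
    pointwise : ∀ i → lookup (delete I v) i ≡ lookup v i
    pointwise i rewrite lookup-delete I v i with membership I i
    ... | inside i∈I eq rewrite eq = ≡.sym (v∈∁I i (x∈p⇒x∉∁p i∈I))
    ... | outside _ eq rewrite eq = refl

  delete-mono-∣ₘ : ∀ I {u v : Mon n} → u ∣ₘ v → delete I u ∣ₘ delete I v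
  delete-mono-∣ₘ I {u} {v} u∣v i rewrite lookup-delete I u i | lookup-delete I v i with lookup I i
  ... | true  = ℕ.z≤n
  ... | false = u∣v i

  ∣ₘ-·ₘ-delete⇒∣ₘ : ∀ {I} {m : Mon n} u w → SupportedIn I m → m ∣ₘ (u ·ₘ delete I w) → m ∣ₘ u
  ∣ₘ-·ₘ-delete⇒∣ₘ {I} u w m∈I m∣ i with membership I i | m∣ i
  ... | inside _ eq | m≤
    rewrite lookup-·ₘ u (delete I w) i | lookup-delete I w i | eq | ℕ.+-identityʳ (lookup u i) = m≤
  ... | outside i∉I _ | _ rewrite m∈I i i∉I = ℕ.z≤n

⊆∧≢⇒⊂ : ∀ {n} {I K : Subset n} → I ⊆ K → I ≢ K → I ⊂ K
⊆∧≢⇒⊂ {n} {I} {K} I⊆K I≢K with Fin.all? (λ x → (x ∈? K) →-dec (x ∈? I))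
... | yes K⊆I = ⊥-elim (I≢K (⊆-antisym I⊆K (K⊆I _)))
... | no K⊈I with Fin.¬∀⟶∃¬ n _ (λ x → (x ∈? K) →-dec (x ∈? I)) K⊈I
...   | x , ¬[x∈K→x∈I] with x ∈? K
...     | yes x∈K = I⊆K , x , x∈K , λ x∈I → ¬[x∈K→x∈I] λ _ → x∈I
...     | no x∉K  = ⊥-elim (¬[x∈K→x∈I] (⊥-elim ∘ x∉K))

-- R, M_{J/I} and R_I are declared inside `Polynomials F n` but do not depend on F.
module MonotoneFamilyProperties {c ℓ} (F : Field c ℓ) {n} {Σs : List (Subset n)}
                                {m : Subset n → Mon n} (mf : MonotoneFamily n Σs m) where
  open MonotoneFamily mf
  open Polynomials F n using (InR; InM; InRI)

  -- w is I-based when its Ī-part lies in R_I. The I-summand of the theorem is spanned by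
  -- the I-based monomials, and those divisible by m_I are the ones in m_I·𝕂[x_I]·R_I.
  Based : Subset n → Mon n → Set
  Based I w = InRI Σs m I (delete I w)

  Leading : Subset n → Mon n → Set
  Leading I w = m I ∣ₘ w × Based I w

  InM⇒∣ₘ : ∀ J I v → InM Σs m J I v → delete I (m J) ∣ₘ v
  InM⇒∣ₘ J I _ (w , _ , refl) i rewrite lookup-·ₘ (delete I (m J)) w i = ℕ.m≤m+n _ _

  ∣ₘ⇒InM : ∀ J I v → SupportedIn (∁ I) v → delete I (m J) ∣ₘ v → InM Σs m J I v
  ∣ₘ⇒InM J I v v∈∁I d∣v = quotient , quotient∈∁I , Mon-ext pointwise
    where
    d = delete I (m J)
    quotient = zipWith ℕ._∸_ v d
    quotient∈∁I : SupportedIn (∁ I) quotient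
    quotient∈∁I i i∉∁I rewrite lookup-zipWith ℕ._∸_ i v d | v∈∁I i i∉∁I = ℕ.0∸n≡0 (lookup d i)
    pointwise : ∀ i → lookup v i ≡ lookup (d ·ₘ quotient) i
    pointwise i rewrite lookup-·ₘ d quotient i | lookup-zipWith ℕ._∸_ i v d = ≡.sym (ℕ.m+[n∸m]≡n (d∣v i))

  inRI? : ∀ I v → Dec (InRI Σs m I v)
  inRI? I v with supportedIn? (∁ I) v
  ... | no v∉∁I = no (v∉∁I ∘ proj₁)
  ... | yes v∈∁I with All.all? (λ J → (I ⊂? J) →-dec ¬? (delete I (m J) ∣ₘ? v)) Σs
  ...   | yes none = yes (v∈∁I , λ J J∈Σ I⊂J v∈M → All.lookup none J∈Σ I⊂J (InM⇒∣ₘ J I v v∈M))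
  ...   | no some  = no λ (_ , none) → some (All.tabulate
                       λ {J} J∈Σ I⊂J d∣v → none J J∈Σ I⊂J (∣ₘ⇒InM J I v v∈∁I d∣v))

  based? : ∀ I w → Dec (Based I w)
  based? I w = inRI? I (delete I w)

  InRI⇒based : ∀ {I v} → InRI Σs m I v → Based I v
  InRI⇒based {I} {v} v∈RI = subst (InRI Σs m I) (≡.sym (delete-supported-∁ v (proj₁ v∈RI))) v∈RI

  based-·ₘ : ∀ {I} u {w} → SupportedIn I u → Based I w → Based I (u ·ₘ w)
  based-·ₘ {I} u {w} u∈𝕂[x_I] w-based = subst (InRI Σs m I) (≡.sym (delete-·ₘ-supported u w u∈𝕂[x_I])) w-based

  based-∣ₘ⇒≡ : ∀ {I K w} → K ∈ Σs → I ⊆ K → delete I (m K) ∣ₘ delete I w → Based I w → K ≡ I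
  based-∣ₘ⇒≡ {I} {K} {w} K∈Σ I⊆K d∣w (_ , notInM) with Vec.≡-dec Bool._≟_ K I
  ... | yes K≡I = K≡I
  ... | no K≢I = ⊥-elim (notInM K K∈Σ (⊆∧≢⇒⊂ I⊆K (K≢I ∘ ≡.sym)) (∣ₘ⇒InM K I _ (delete-supported I w) d∣w))

  leading-unique : ∀ {I J w} → I ∈ Σs → J ∈ Σs → Leading I w → Leading J w → I ≡ J
  leading-unique {I} {J} {w} I∈Σ J∈Σ (mI∣w , I-based) (mJ∣w , J-based) =
    let K , K∈Σ , I∪J⊆K , mK∣lcm = MM3 I∈Σ J∈Σ
        mK∣w = ∣ₘ-lcmₘ⇒∣ₘ (m K) (m I) (m J) w mK∣lcm mI∣w mJ∣w
        K≡I = based-∣ₘ⇒≡ K∈Σ (I∪J⊆K ∘ p⊆p∪q J) (delete-mono-∣ₘ I mK∣w) I-based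
        K≡J = based-∣ₘ⇒≡ K∈Σ (I∪J⊆K ∘ q⊆p∪q I J) (delete-mono-∣ₘ J mK∣w) J-based
    in ≡.trans (≡.sym K≡I) K≡J

  leading-below-based : ∀ {I J w} → I ∈ Σs → J ∈ Σs → ¬ m I ∣ₘ w → Based I w → Leading J w → J ⊂ I
  leading-below-based {I} {J} {w} I∈Σ J∈Σ mI∤w I-based (mJ∣w , _) with MM3 I∈Σ J∈Σ
  ... | K , K∈Σ , I∪J⊆K , mK∣lcm = ⊆∧≢⇒⊂ J⊆I λ J≡I → mI∤w (subst (λ Z → m Z ∣ₘ w) J≡I mJ∣w)
    where
    -- off I, lcm(m_I, m_J) = m_J by (MM1)
    mK/I∣w/I : delete I (m K) ∣ₘ delete I w
    mK/I∣w/I i rewrite lookup-delete I (m K) i | lookup-delete I w i with membership I i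
    ... | inside _ eq rewrite eq = ℕ.z≤n
    ... | outside i∉I eq rewrite eq = ℕ.≤-trans (mK∣lcm i)
          (subst (ℕ._≤ lookup w i) (≡.sym (≡.trans (lookup-lcmₘ (m I) (m J) i)
                                                  (cong (ℕ._⊔ lookup (m J) i) (MM1 I∈Σ i i∉I))))
                 (mJ∣w i))
    J⊆I : J ⊆ I
    J⊆I = subst (J ⊆_) (based-∣ₘ⇒≡ K∈Σ (I∪J⊆K ∘ p⊆p∪q J) mK/I∣w/I I-based) (I∪J⊆K ∘ q⊆p∪q I J)

  leading⇒⊆-based : ∀ {I J w} → I ∈ Σs → J ∈ Σs → Based J w → Leading I w → I ≡ J ⊎ I ⊂ J
  leading⇒⊆-based {I} {J} {w} I∈Σ J∈Σ J-based I-leading with m J ∣ₘ? w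
  ... | yes mJ∣w = inj₁ (leading-unique I∈Σ J∈Σ I-leading (mJ∣w , J-based))
  ... | no mJ∤w  = inj₂ (leading-below-based J∈Σ I∈Σ mJ∤w J-based I-leading)

  largest-divisor : ∀ w {K₀} → K₀ ∈ Σs → m K₀ ∣ₘ w → (L : List (Subset n)) → (∀ {J} → J ∈ L → J ∈ Σs) →
                    ∃[ K ] (K ∈ Σs × m K ∣ₘ w × (∀ {J} → J ∈ L → m J ∣ₘ w → J ⊆ K))
  largest-divisor w K₀∈Σ mK₀∣w [] _ = _ , K₀∈Σ , mK₀∣w , λ ()
  largest-divisor w K₀∈Σ mK₀∣w (J ∷ L) L⊆Σ
    with largest-divisor w K₀∈Σ mK₀∣w L (L⊆Σ ∘ there) | m J ∣ₘ? w
  ... | K , K∈Σ , mK∣w , largest | no mJ∤w =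
    K , K∈Σ , mK∣w , λ { (here refl) mJ∣w → ⊥-elim (mJ∤w mJ∣w) ; (there J′∈L) → largest J′∈L }
  ... | K , K∈Σ , mK∣w , largest | yes mJ∣w =
    let K′ , K′∈Σ , K∪J⊆K′ , mK′∣lcm = MM3 K∈Σ (L⊆Σ (here refl))
    in K′ , K′∈Σ , ∣ₘ-lcmₘ⇒∣ₘ (m K′) (m K) (m J) w mK′∣lcm mK∣w mJ∣w ,
       λ { (here refl) _ → K∪J⊆K′ ∘ q⊆p∪q K J ; (there J′∈L) mJ′∣w → K∪J⊆K′ ∘ p⊆p∪q J ∘ largest J′∈L mJ′∣w }

  R⊎leading : ∀ w → InR Σs m w ⊎ ∃[ I ] (I ∈ Σs × Leading I w)
  R⊎leading w with any? (λ I → m I ∣ₘ? w) Σs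
  ... | no none = inj₁ λ I I∈Σ mI∣w → none (lose I∈Σ mI∣w)
  ... | yes some with find some
  ...   | K₀ , K₀∈Σ , mK₀∣w with largest-divisor w K₀∈Σ mK₀∣w Σs (λ J∈Σ → J∈Σ)
  ...     | K , K∈Σ , mK∣w , largest = inj₂ (K , K∈Σ , mK∣w , delete-supported K w , notInM)
    where
    -- a J ⊋ K with m_{J/K} ∣ w_K̄ would have m_J ∣ w, by (MM2) on K
    notInM : ∀ J → J ∈ Σs → K ⊂ J → ¬ InM Σs m J K (delete K w)
    notInM J J∈Σ (K⊆J , x , x∈J , x∉K) v∈M = x∉K (largest J∈Σ mJ∣w x∈J)
      where
      mJ/K∣w/K = InM⇒∣ₘ J K _ v∈M
      mJ∣w : m J ∣ₘ w
      mJ∣w i with membership K i | mJ/K∣w/K i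
      ... | inside i∈K _ | _ = ℕ.≤-trans (MM2 K∈Σ J∈Σ K⊆J i i∈K) (mK∣w i)
      ... | outside _ eq | ≤ rewrite lookup-delete K (m J) i | lookup-delete K w i | eq = ≤

module PolynomialAlgebra {c ℓ} (F : Field c ℓ) (n : ℕ) where
  open Field F renaming (refl to ≈-refl; sym to ≈-sym; trans to ≈-trans; reflexive to ≈-reflexive)
  open RingProperties ring using (-‿distribˡ-*; -‿+-comm; -0#≈0#; x∙y⁻¹≈ε⇒x≈y)
  open CommutativeSemigroupProperties +-commutativeSemigroup using (interchange; x∙yz≈y∙xz)
  open Polynomials F n
  module ≈-Reasoning = SetoidReasoning setoid

  _≟ₘ_ : (u v : Mon n) → Dec (u ≡ v)
  _≟ₘ_ = Vec.≡-dec ℕ._≟_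

  -- The linear functional extending h : Mon n → Carrier; coefficients of products are computed
  -- through it.
  eval : (Mon n → Carrier) → Poly → Carrier
  eval h [] = 0#
  eval h ((a , u) ∷ f) = a * h u + eval h f

  δ : Mon n → Mon n → Carrier
  δ w v with v ≟ₘ w
  ... | yes _ = 1#
  ... | no _  = 0#

  δ-≢ : ∀ {w v} → v ≢ w → δ w v ≈ 0#
  δ-≢ {w} {v} v≢w with v ≟ₘ w
  ... | yes v≡w = ⊥-elim (v≢w v≡w)
  ... | no _    = ≈-refl

  coeff-eval : ∀ f w → coeff f w ≈ eval (δ w) f
  coeff-eval [] w = ≈-refl
  coeff-eval ((a , v) ∷ f) w with v ≟ₘ w
  ... | yes _ = +-cong (≈-sym (*-identityʳ a)) (coeff-eval f w)
  ... | no _  = ≈-trans (coeff-eval f w) (≈-trans (≈-sym (+-identityˡ _)) (+-cong (≈-sym (zeroʳ a)) ≈-refl))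

  eval-++ : ∀ h f g → eval h (f ++ g) ≈ eval h f + eval h g
  eval-++ h [] g = ≈-sym (+-identityˡ _)
  eval-++ h ((a , u) ∷ f) g = ≈-trans (+-cong ≈-refl (eval-++ h f g)) (≈-sym (+-assoc _ _ _))

  eval-cong : ∀ {h h′} f → (∀ u → h u ≈ h′ u) → eval h f ≈ eval h′ f
  eval-cong [] _ = ≈-refl
  eval-cong ((a , u) ∷ f) h≈h′ = +-cong (*-cong ≈-refl (h≈h′ u)) (eval-cong f h≈h′)

  eval-congᴬ : ∀ {S : Mon n → Set} {h h′} f → All (S ∘ proj₂) f → (∀ u → S u → h u ≈ h′ u) →
               eval h f ≈ eval h′ f
  eval-congᴬ [] [] _ = ≈-refl
  eval-congᴬ ((a , u) ∷ f) (s ∷ ss) h≈h′ = +-cong (*-cong ≈-refl (h≈h′ u s)) (eval-congᴬ f ss h≈h′)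

  eval-zero : ∀ f → eval (λ _ → 0#) f ≈ 0#
  eval-zero [] = ≈-refl
  eval-zero ((a , u) ∷ f) = ≈-trans (+-cong (zeroʳ a) (eval-zero f)) (+-identityˡ _)

  eval-vanishing : ∀ {S : Mon n → Set} {h} f → All (S ∘ proj₂) f → (∀ u → S u → h u ≈ 0#) → eval h f ≈ 0#
  eval-vanishing f sf h≈0 = ≈-trans (eval-congᴬ f sf h≈0) (eval-zero f)

  eval-+ : ∀ h h′ f → eval (λ u → h u + h′ u) f ≈ eval h f + eval h′ f
  eval-+ h h′ [] = ≈-sym (+-identityˡ _)
  eval-+ h h′ ((a , u) ∷ f) =
    ≈-trans (+-cong (distribˡ a _ _) (eval-+ h h′ f)) (interchange _ _ _ _)

  neg : Poly → Poly
  neg = map λ (a , u) → - a , u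

  eval-neg : ∀ h f → eval h (neg f) ≈ - eval h f
  eval-neg h [] = ≈-sym -0#≈0#
  eval-neg h ((a , u) ∷ f) =
    ≈-trans (+-cong (≈-sym (-‿distribˡ-* a (h u))) (eval-neg h f)) (-‿+-comm _ _)

  eval-*ₚ : ∀ h f g → eval h (f *ₚ g) ≈ eval (λ u → eval (λ v → h (u ·ₘ v)) g) f
  eval-*ₚ h [] g = ≈-refl
  eval-*ₚ h ((a , u) ∷ f) g =
    ≈-trans (eval-++ h (map (λ (b , v) → a * b , u ·ₘ v) g) (f *ₚ g))
            (+-cong (eval-scaled g) (eval-*ₚ h f g))
    where
    eval-scaled : ∀ g → eval h (map (λ (b , v) → a * b , u ·ₘ v) g) ≈ a * eval (λ v → h (u ·ₘ v)) g
    eval-scaled [] = ≈-sym (zeroʳ a)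
    eval-scaled ((b , v) ∷ g) =
      ≈-trans (+-cong (*-assoc a b _) (eval-scaled g)) (≈-sym (distribˡ a _ _))

  restrict : {P : Mon n → Set} → Decidable P → Poly → Poly
  restrict P? = filter (P? ∘ proj₂)

  module _ {P : Mon n → Set} (P? : Decidable P) where

    coeff-restrict : ∀ f {w} → P w → coeff (restrict P? f) w ≈ coeff f w
    coeff-restrict [] _ = ≈-refl
    coeff-restrict ((a , v) ∷ f) {w} Pw with P? v
    ... | yes _ with v ≟ₘ w
    ...   | yes _ = +-cong ≈-refl (coeff-restrict f Pw)
    ...   | no _  = coeff-restrict f Pw
    coeff-restrict ((a , v) ∷ f) {w} Pw | no ¬Pv with v ≟ₘ w
    ...   | yes refl = ⊥-elim (¬Pv Pw)
    ...   | no _     = coeff-restrict f Pw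

    coeff-restrict-∉ : ∀ f {w} → ¬ P w → coeff (restrict P? f) w ≈ 0#
    coeff-restrict-∉ [] _ = ≈-refl
    coeff-restrict-∉ ((a , v) ∷ f) {w} ¬Pw with P? v
    ... | no _ = coeff-restrict-∉ f ¬Pw
    ... | yes Pv with v ≟ₘ w
    ...   | yes refl = ⊥-elim (¬Pw Pv)
    ...   | no _     = coeff-restrict-∉ f ¬Pw

  eval-split : ∀ h u f → eval h f ≈ coeff f u * h u + eval h (restrict (¬? ∘ (_≟ₘ u)) f)
  eval-split h u [] = ≈-sym (≈-trans (+-cong (zeroˡ _) ≈-refl) (+-identityˡ _))
  eval-split h u ((a , v) ∷ f) with v ≟ₘ u
  ... | yes refl = ≈-trans (+-cong ≈-refl (eval-split h u f))
                     (≈-trans (≈-sym (+-assoc _ _ _)) (+-cong (≈-sym (distribʳ (h u) a _)) ≈-refl))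
  ... | no _     = ≈-trans (+-cong ≈-refl (eval-split h u f)) (x∙yz≈y∙xz _ _ _)

  eval-coeff-zero : ∀ f → (∀ u → coeff f u ≈ 0#) → ∀ h → eval h f ≈ 0#
  eval-coeff-zero f = bounded f ℕ.≤-refl
    where
    bounded : ∀ {k} f → length f ℕ.≤ k → (∀ u → coeff f u ≈ 0#) → ∀ h → eval h f ≈ 0#
    bounded [] _ _ _ = ≈-refl
    bounded {ℕ.suc k} f@((a , u) ∷ f′) (ℕ.s≤s |f′|≤k) f≈0 h = begin
      eval h f                                         ≈⟨ eval-split h u f ⟩
      coeff f u * h u + eval h (restrict ≢u? f)        ≈⟨ +-cong (≈-trans (*-cong (f≈0 u) ≈-refl) (zeroˡ _))
                                                                 (bounded (restrict ≢u? f) shorter rest≈0 h) ⟩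
      0# + 0#                                          ≈⟨ +-identityʳ _ ⟩
      0#                                               ∎
      where
      open ≈-Reasoning
      ≢u? = ¬? ∘ (_≟ₘ u)
      shorter : length (restrict ≢u? f) ℕ.≤ k
      shorter rewrite List.filter-reject (≢u? ∘ proj₂) {x = a , u} {xs = f′} (λ u≢u → u≢u refl) =
        ℕ.≤-trans (List.length-filter (≢u? ∘ proj₂) f′) |f′|≤k
      rest≈0 : ∀ w → coeff (restrict ≢u? f) w ≈ 0#
      rest≈0 w with w ≟ₘ u
      ... | yes w≡u = coeff-restrict-∉ ≢u? f (λ w≢u → w≢u w≡u)
      ... | no w≢u  = ≈-trans (coeff-restrict ≢u? f w≢u) (f≈0 w)

  -- `_≈ₚ_` wrapped in a record, so that the compared polynomials can be inferred.
  infix 4 _≋_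
  record _≋_ (f g : Poly) : Set ℓ where
    constructor mk≋
    field coeff-≈ : f ≈ₚ g
  open _≋_ public

  ≋-setoid : Setoid c ℓ
  ≋-setoid = record
    { Carrier = Poly
    ; _≈_ = _≋_
    ; isEquivalence = record
      { refl = mk≋ λ _ → ≈-refl
      ; sym = λ (mk≋ f≈g) → mk≋ λ w → ≈-sym (f≈g w)
      ; trans = λ (mk≋ f≈g) (mk≋ g≈h) → mk≋ λ w → ≈-trans (f≈g w) (g≈h w)
      }
    }
  open Setoid ≋-setoid public using () renaming (refl to ≋-refl; sym to ≋-sym; trans to ≋-trans)
  module ≋-Reasoning = SetoidReasoning ≋-setoid

  coeff-neg : ∀ f w → coeff (neg f) w ≈ - coeff f w
  coeff-neg f w = ≈-trans (coeff-eval (neg f) w) (≈-trans (eval-neg (δ w) f) (-‿cong (≈-sym (coeff-eval f w))))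

  coeff-++ : ∀ f g w → coeff (f ++ g) w ≈ coeff f w + coeff g w
  coeff-++ f g w =
    ≈-trans (coeff-eval (f ++ g) w)
            (≈-trans (eval-++ (δ w) f g) (+-cong (≈-sym (coeff-eval f w)) (≈-sym (coeff-eval g w))))

  eval-resp-≋ : ∀ {f g} → f ≋ g → ∀ h → eval h f ≈ eval h g
  eval-resp-≋ {f} {g} (mk≋ f≈g) h = x∙y⁻¹≈ε⇒x≈y _ _ (begin
    eval h f + - eval h g       ≈⟨ +-cong ≈-refl (eval-neg h g) ⟨
    eval h f + eval h (neg g)   ≈⟨ eval-++ h f (neg g) ⟨
    eval h (f ++ neg g)         ≈⟨ eval-coeff-zero (f ++ neg g) difference≈0 h ⟩
    0#                          ∎)
    where
    open ≈-Reasoning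
    difference≈0 : ∀ w → coeff (f ++ neg g) w ≈ 0#
    difference≈0 w = ≈-trans (coeff-++ f (neg g) w)
                       (≈-trans (+-cong (f≈g w) (coeff-neg g w)) (-‿inverseʳ _))

  coeff-*ₚ : ∀ f g w → coeff (f *ₚ g) w ≈ eval (λ u → eval (λ v → δ w (u ·ₘ v)) g) f
  coeff-*ₚ f g w = ≈-trans (coeff-eval (f *ₚ g) w) (eval-*ₚ (δ w) f g)

  ++-cong : ∀ {f f′ g g′} → f ≋ f′ → g ≋ g′ → f ++ g ≋ f′ ++ g′
  ++-cong {f} {f′} {g} {g′} (mk≋ f≈f′) (mk≋ g≈g′) =
    mk≋ λ w → ≈-trans (coeff-++ f g w) (≈-trans (+-cong (f≈f′ w) (g≈g′ w)) (≈-sym (coeff-++ f′ g′ w)))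

  ++-identityʳ : ∀ f → f ++ [] ≋ f
  ++-identityʳ f = mk≋ λ w → ≈-reflexive (cong (λ k → coeff k w) (List.++-identityʳ f))

  ++-interchange : ∀ f g h k → (f ++ g) ++ (h ++ k) ≋ (f ++ h) ++ (g ++ k)
  ++-interchange f g h k = mk≋ λ w → begin
    coeff ((f ++ g) ++ (h ++ k)) w                          ≈⟨ split f g h k w ⟩
    (coeff f w + coeff g w) + (coeff h w + coeff k w)       ≈⟨ interchange _ _ _ _ ⟩
    (coeff f w + coeff h w) + (coeff g w + coeff k w)       ≈⟨ split f h g k w ⟨
    coeff ((f ++ h) ++ (g ++ k)) w                          ∎
    where
    open ≈-Reasoning
    split : ∀ f g h k w → coeff ((f ++ g) ++ (h ++ k)) w ≈ (coeff f w + coeff g w) + (coeff h w + coeff k w)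
    split f g h k w = ≈-trans (coeff-++ (f ++ g) (h ++ k) w) (+-cong (coeff-++ f g w) (coeff-++ h k w))

  *ₚ-congʳ : ∀ {f f′} g → f ≋ f′ → f *ₚ g ≋ f′ *ₚ g
  *ₚ-congʳ {f} {f′} g f≋f′ =
    mk≋ λ w → ≈-trans (coeff-*ₚ f g w) (≈-trans (eval-resp-≋ f≋f′ _) (≈-sym (coeff-*ₚ f′ g w)))

  *ₚ-congˡ : ∀ f {g g′} → g ≋ g′ → f *ₚ g ≋ f *ₚ g′
  *ₚ-congˡ f {g} {g′} g≋g′ =
    mk≋ λ w → ≈-trans (coeff-*ₚ f g w) (≈-trans (eval-cong f (λ _ → eval-resp-≋ g≋g′ _)) (≈-sym (coeff-*ₚ f g′ w)))

  *ₚ-distribˡ : ∀ f g g′ → f *ₚ (g ++ g′) ≋ f *ₚ g ++ f *ₚ g′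
  *ₚ-distribˡ f g g′ = mk≋ λ w → begin
    coeff (f *ₚ (g ++ g′)) w                                            ≈⟨ coeff-*ₚ f (g ++ g′) w ⟩
    eval (λ u → eval (λ v → δ w (u ·ₘ v)) (g ++ g′)) f                  ≈⟨ eval-cong f (λ _ → eval-++ _ g g′) ⟩
    eval (λ u → eval (λ v → δ w (u ·ₘ v)) g + eval (λ v → δ w (u ·ₘ v)) g′) f ≈⟨ eval-+ _ _ f ⟩
    eval (λ u → eval (λ v → δ w (u ·ₘ v)) g) f + eval (λ u → eval (λ v → δ w (u ·ₘ v)) g′) f
                                                                        ≈⟨ +-cong (coeff-*ₚ f g w) (coeff-*ₚ f g′ w) ⟨
    coeff (f *ₚ g) w + coeff (f *ₚ g′) w                                ≈⟨ coeff-++ (f *ₚ g) (f *ₚ g′) w ⟨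
    coeff (f *ₚ g ++ f *ₚ g′) w                                         ∎
    where open ≈-Reasoning

  *ₚ-distribʳ : ∀ f f′ g → (f ++ f′) *ₚ g ≋ f *ₚ g ++ f′ *ₚ g
  *ₚ-distribʳ f f′ g = mk≋ λ w → ≈-reflexive (cong (λ k → coeff k w) (List.concatMap-++ _ f f′))

  *ₚ-assoc : ∀ f g h → (f *ₚ g) *ₚ h ≋ f *ₚ (g *ₚ h)
  *ₚ-assoc f g h = mk≋ λ w → begin
    coeff ((f *ₚ g) *ₚ h) w                                             ≈⟨ coeff-*ₚ (f *ₚ g) h w ⟩
    eval (λ y → eval (λ z → δ w (y ·ₘ z)) h) (f *ₚ g)                   ≈⟨ eval-*ₚ _ f g ⟩
    eval (λ u → eval (λ x → eval (λ z → δ w ((u ·ₘ x) ·ₘ z)) h) g) f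
      ≈⟨ eval-cong f (λ u → eval-cong g (λ x → eval-cong h (λ z → ≈-reflexive (cong (δ w) (·ₘ-assoc u x z))))) ⟩
    eval (λ u → eval (λ x → eval (λ z → δ w (u ·ₘ (x ·ₘ z))) h) g) f    ≈⟨ eval-cong f (λ u → eval-*ₚ _ g h) ⟨
    eval (λ u → eval (λ y → δ w (u ·ₘ y)) (g *ₚ h)) f                   ≈⟨ coeff-*ₚ f (g *ₚ h) w ⟨
    coeff (f *ₚ (g *ₚ h)) w                                             ∎
    where open ≈-Reasoning

  *ₚ-zeroʳ : ∀ f → f *ₚ [] ≋ []
  *ₚ-zeroʳ f = mk≋ λ w → ≈-trans (coeff-*ₚ f [] w) (eval-zero f)

  term-cong : ∀ {a b} u → a ≈ b → (a , u) ∷ [] ≋ (b , u) ∷ []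
  term-cong {a} {b} u a≈b = mk≋ λ w → ≈-trans (coeff-eval ((a , u) ∷ []) w)
    (≈-trans (+-cong (*-cong a≈b ≈-refl) ≈-refl) (≈-sym (coeff-eval ((b , u) ∷ []) w)))

  mono : Mon n → Poly
  mono v = (1# , v) ∷ []

  coeff-*ₚ-mono : ∀ f v y → coeff (f *ₚ mono v) (y ·ₘ v) ≈ coeff f y
  coeff-*ₚ-mono f v y = begin
    coeff (f *ₚ mono v) (y ·ₘ v)                   ≈⟨ coeff-*ₚ f (mono v) (y ·ₘ v) ⟩
    eval (λ u → 1# * δ (y ·ₘ v) (u ·ₘ v) + 0#) f    ≈⟨ eval-cong f δ-shift ⟩
    eval (δ y) f                                   ≈⟨ coeff-eval f y ⟨
    coeff f y                                      ∎
    where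
    open ≈-Reasoning
    δ-shift : ∀ u → 1# * δ (y ·ₘ v) (u ·ₘ v) + 0# ≈ δ y u
    δ-shift u with u ≟ₘ y | (u ·ₘ v) ≟ₘ (y ·ₘ v)
    ... | yes _   | yes _  = ≈-trans (+-identityʳ _) (*-identityˡ _)
    ... | yes u≡y | no uv≢yv = ⊥-elim (uv≢yv (cong (_·ₘ v) u≡y))
    ... | no u≢y  | yes uv≡yv = ⊥-elim (u≢y (·ₘ-cancelʳ u y v uv≡yv))
    ... | no _    | no _   = ≈-trans (+-identityʳ _) (*-identityˡ _)

  all-*ₚ-mono : ∀ {S T : Mon n → Set} v f → All (S ∘ proj₂) f → (∀ u → S u → T (u ·ₘ v)) →
                All (T ∘ proj₂) (f *ₚ mono v)
  all-*ₚ-mono v [] [] _ = []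
  all-*ₚ-mono v ((a , u) ∷ f) (s ∷ ss) S⇒T = S⇒T u s ∷ all-*ₚ-mono v f ss S⇒T

  all⇒span : ∀ {S : Mon n → Set} f → All (S ∘ proj₂) f → InSpan S f
  all⇒span f sf w ¬Sw = ≈-trans (coeff-eval f w) (eval-vanishing f sf λ u Su → δ-≢ {w} {u} λ { refl → ¬Sw Su })

  restrict-≋ : ∀ {S : Mon n → Set} (S? : Decidable S) f → InSpan S f → restrict S? f ≋ f
  restrict-≋ S? f f∈⟨S⟩ = mk≋ pointwise
    where
    pointwise : ∀ w → coeff (restrict S? f) w ≈ coeff f w
    pointwise w with S? w
    ... | yes Sw = coeff-restrict S? f Sw
    ... | no ¬Sw = ≈-trans (coeff-restrict-∉ S? f ¬Sw) (≈-sym (f∈⟨S⟩ w ¬Sw))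

  span-resp-≋ : ∀ {S : Mon n → Set} {f g} → f ≋ g → InSpan S g → InSpan S f
  span-resp-≋ (mk≋ f≈g) g∈⟨S⟩ w ¬Sw = ≈-trans (f≈g w) (g∈⟨S⟩ w ¬Sw)

  ++-span : ∀ {S : Mon n → Set} f g → InSpan S f → InSpan S g → InSpan S (f ++ g)
  ++-span f g f∈⟨S⟩ g∈⟨S⟩ w ¬Sw =
    ≈-trans (coeff-++ f g w) (≈-trans (+-cong (f∈⟨S⟩ w ¬Sw) (g∈⟨S⟩ w ¬Sw)) (+-identityˡ _))

  *ₚ-span : ∀ {S T U : Mon n → Set} → (∀ u x → S u → T x → U (u ·ₘ x)) → ∀ f g →
            All (S ∘ proj₂) f → All (T ∘ proj₂) g → InSpan U (f *ₚ g)
  *ₚ-span {U = U} ST⇒U f g sf tg w ¬Uw = ≈-trans (coeff-*ₚ f g w)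
    (eval-vanishing f sf λ u Su → eval-vanishing g tg λ x Tx →
      δ-≢ {w} {u ·ₘ x} λ ux≡w → ¬Uw (subst U ux≡w (ST⇒U u x Su Tx)))

  module _ {A : Set} where

    sumₚ-cong : ∀ (f g : A → Poly) L → (∀ I → f I ≋ g I) → sumₚ (map f L) ≋ sumₚ (map g L)
    sumₚ-cong f g [] _ = ≋-refl
    sumₚ-cong f g (I ∷ L) f≋g = ++-cong (f≋g I) (sumₚ-cong f g L f≋g)

    sumₚ-++ : ∀ (f g : A → Poly) L → sumₚ (map (λ I → f I ++ g I) L) ≋ sumₚ (map f L) ++ sumₚ (map g L)
    sumₚ-++ f g [] = ≋-refl
    sumₚ-++ f g (I ∷ L) =
      ≋-trans (++-cong (≋-refl {f I ++ g I}) (sumₚ-++ f g L)) (++-interchange (f I) (g I) _ _)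

    coeff-sumₚ-vanishing : ∀ (f : A → Poly) L w → (∀ {J} → J ∈ L → coeff (f J) w ≈ 0#) →
                           coeff (sumₚ (map f L)) w ≈ 0#
    coeff-sumₚ-vanishing f [] w _ = ≈-refl
    coeff-sumₚ-vanishing f (J ∷ L) w f≈0 = ≈-trans (coeff-++ (f J) _ w)
      (≈-trans (+-cong (f≈0 (here refl)) (coeff-sumₚ-vanishing f L w (f≈0 ∘ there))) (+-identityˡ _))

    coeff-sumₚ-single : ∀ (f : A → Poly) {L I} w → Unique L → I ∈ L →
                        (∀ {J} → J ∈ L → J ≢ I → coeff (f J) w ≈ 0#) → coeff (sumₚ (map f L)) w ≈ coeff (f I) w
    coeff-sumₚ-single f {J ∷ L} w (J∉L ∷ _) (here refl) others≈0 = ≈-trans (coeff-++ (f J) _ w)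
      (≈-trans (+-cong ≈-refl (coeff-sumₚ-vanishing f L w λ J′∈L →
                                 others≈0 (there J′∈L) λ { refl → All.lookup J∉L J′∈L refl }))
               (+-identityʳ _))
    coeff-sumₚ-single f {J ∷ L} w (J∉L ∷ L-unique) (there I∈L) others≈0 = ≈-trans (coeff-++ (f J) _ w)
      (≈-trans (+-cong (others≈0 (here refl) λ { refl → All.lookup J∉L I∈L refl })
                       (coeff-sumₚ-single f w L-unique I∈L (others≈0 ∘ there)))
               (+-identityˡ _))

  restrict-partition : ∀ {P : Mon n → Set} (P? : Decidable P) f → f ≋ restrict P? f ++ restrict (¬? ∘ P?) f
  restrict-partition P? f = mk≋ λ w → ≈-trans (pointwise w) (≈-sym (coeff-++ (restrict P? f) _ w))
    where
    pointwise : ∀ w → coeff f w ≈ coeff (restrict P? f) w + coeff (restrict (¬? ∘ P?) f) w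
    pointwise w with P? w
    ... | yes Pw = ≈-sym (≈-trans (+-cong (coeff-restrict P? f Pw) (coeff-restrict-∉ (¬? ∘ P?) f (λ ¬Pw → ¬Pw Pw)))
                                  (+-identityʳ _))
    ... | no ¬Pw = ≈-sym (≈-trans (+-cong (coeff-restrict-∉ P? f ¬Pw) (coeff-restrict (¬? ∘ P?) f ¬Pw))
                                  (+-identityˡ _))

module DeformationProperties {c ℓ} (F : Field c ℓ) {n} {I : Subset n} {μ : Mon n}
                             {p : Polynomials.Poly F n} (D : Polynomials.IDeformation F n I μ p) where
  open Field F renaming (refl to ≈-refl; sym to ≈-sym; trans to ≈-trans)
  open Polynomials F n
  open PolynomialAlgebra F n
  open IDeformation D

  multiple-in-Rm⇒zero : ∀ q → InVars I q → InRm I μ (p *ₚ q) → p *ₚ q ≋ []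
  multiple-in-Rm⇒zero q q∈𝕂[x_I] pq∈⟨Rm⟩ =
    mk≋ (proj₂ (independent (neg (p *ₚ q)) q neg-pq∈⟨Rm⟩ q∈𝕂[x_I] −pq+pq≈0))
    where
    neg-pq∈⟨Rm⟩ : InRm I μ (neg (p *ₚ q))
    neg-pq∈⟨Rm⟩ w w∉Rm = ≈-trans (coeff-neg (p *ₚ q) w) (≈-trans (-‿cong (pq∈⟨Rm⟩ w w∉Rm)) -0#≈0#)
      where open RingProperties ring using (-0#≈0#)
    −pq+pq≈0 : neg (p *ₚ q) +ₚ p *ₚ q ≈ₚ 0ₚ
    −pq+pq≈0 w = ≈-trans (coeff-++ (neg (p *ₚ q)) (p *ₚ q) w)
                         (≈-trans (+-cong (coeff-neg (p *ₚ q) w) ≈-refl) (-‿inverseˡ _))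

  keepPart : Poly → Poly
  keepPart = map λ (a , x) → a , keep I x

  keepPart-*ₚ-mono : ∀ v h → All ((_≡ v) ∘ delete I ∘ proj₂) h → keepPart h *ₚ mono v ≋ h
  keepPart-*ₚ-mono v [] [] = ≋-refl
  keepPart-*ₚ-mono v ((a , x) ∷ h) (refl ∷ rest) =
    ++-cong (subst (λ y → (a * 1# , y) ∷ [] ≋ (a , x) ∷ []) (≡.sym (keep-·ₘ-delete I x))
                   (term-cong x (*-identityʳ a)))
            (keepPart-*ₚ-mono v h rest)

  all-keepPart : ∀ h → All (SupportedIn I ∘ proj₂) (keepPart h)
  all-keepPart [] = []
  all-keepPart ((a , x) ∷ h) = keep-supported I x ∷ all-keepPart h

  fibre : Mon n → Poly → Poly
  fibre v = restrict λ x → delete I x ≟ₘ v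

  p′ : Poly
  p′ = restrict (supportedIn? I) p

  p′≋p : p′ ≋ p
  p′≋p = restrict-≋ (supportedIn? I) p inVars

  coeff-*ₚ-fibre : ∀ g {z v} → delete I z ≡ v → coeff (p *ₚ g) z ≈ coeff (p *ₚ fibre v g) z
  coeff-*ₚ-fibre g {z} {v} z∈fibre = begin
    coeff (p *ₚ g) z                                            ≈⟨ coeff-≈ (*ₚ-congˡ p (restrict-partition ∈fibre? g)) z ⟩
    coeff (p *ₚ (fibre v g ++ rest)) z                          ≈⟨ coeff-≈ (*ₚ-distribˡ p (fibre v g) rest) z ⟩
    coeff (p *ₚ fibre v g ++ p *ₚ rest) z                       ≈⟨ coeff-++ (p *ₚ fibre v g) (p *ₚ rest) z ⟩
    coeff (p *ₚ fibre v g) z + coeff (p *ₚ rest) z              ≈⟨ +-cong ≈-refl (coeff-≈ (*ₚ-congʳ rest p′≋p) z) ⟨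
    coeff (p *ₚ fibre v g) z + coeff (p′ *ₚ rest) z             ≈⟨ +-cong ≈-refl p′rest≈0 ⟩
    coeff (p *ₚ fibre v g) z + 0#                               ≈⟨ +-identityʳ _ ⟩
    coeff (p *ₚ fibre v g) z                                    ∎
    where
    open ≈-Reasoning
    ∈fibre? = λ x → delete I x ≟ₘ v
    rest = restrict (¬? ∘ ∈fibre?) g
    p′rest≈0 : coeff (p′ *ₚ rest) z ≈ 0#
    p′rest≈0 = *ₚ-span {U = λ y → delete I y ≢ v}
                 (λ u x u∈𝕂[x_I] x∉fibre → x∉fibre ∘ ≡.trans (≡.sym (delete-·ₘ-supported u x u∈𝕂[x_I])))
                 p′ rest (all-filter (supportedIn? I ∘ proj₂) p) (all-filter (¬? ∘ ∈fibre? ∘ proj₂) g)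
                 z (λ z∉fibre → z∉fibre z∈fibre)

  coeff-*ₚ-keepPart-fibre : ∀ g {u v} → SupportedIn I u → SupportedIn (∁ I) v →
                            coeff (p *ₚ keepPart (fibre v g)) u ≈ coeff (p *ₚ g) (u ·ₘ v)
  coeff-*ₚ-keepPart-fibre g {u} {v} u∈𝕂[x_I] v∈𝔐Ī = begin
    coeff (p *ₚ B) u                        ≈⟨ coeff-*ₚ-mono (p *ₚ B) v u ⟨
    coeff ((p *ₚ B) *ₚ mono v) (u ·ₘ v)     ≈⟨ coeff-≈ (*ₚ-assoc p B (mono v)) (u ·ₘ v) ⟩
    coeff (p *ₚ (B *ₚ mono v)) (u ·ₘ v)     ≈⟨ coeff-≈ (*ₚ-congˡ p (keepPart-*ₚ-mono v (fibre v g) in-fibre)) (u ·ₘ v) ⟩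
    coeff (p *ₚ fibre v g) (u ·ₘ v)         ≈⟨ coeff-*ₚ-fibre g uv∈fibre ⟨
    coeff (p *ₚ g) (u ·ₘ v)                 ∎
    where
    open ≈-Reasoning
    B = keepPart (fibre v g)
    in-fibre = all-filter ((λ x → delete I x ≟ₘ v) ∘ proj₂) g
    uv∈fibre : delete I (u ·ₘ v) ≡ v
    uv∈fibre = ≡.trans (delete-·ₘ-supported u v u∈𝕂[x_I]) (delete-supported-∁ v v∈𝔐Ī)

  -- Grouping monomials by their Ī-part v reduces this to the independence of p in 𝕂[x_I].
  multiple-without-μ⇒zero : ∀ g → InSpan (λ y → ¬ μ ∣ₘ y) (p *ₚ g) → p *ₚ g ≋ []
  multiple-without-μ⇒zero g pg∈⟨μ∤⟩ = mk≋ coeff≈0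
    where
    open ≈-Reasoning
    pB∈⟨Rm⟩ : ∀ {v} → SupportedIn (∁ I) v → InRm I μ (p *ₚ keepPart (fibre v g))
    pB∈⟨Rm⟩ {v} v∈𝔐Ī u u∉Rm with supportedIn? I u
    ... | no u∉𝕂[x_I] = ≈-trans (≈-sym (coeff-≈ (*ₚ-congʳ B p′≋p) u))
                          (*ₚ-span ·ₘ-supported p′ B (all-filter (supportedIn? I ∘ proj₂) p) (all-keepPart _)
                                   u u∉𝕂[x_I])
      where B = keepPart (fibre v g)
    ... | yes u∈𝕂[x_I] with μ ∣ₘ? u
    ...   | no μ∤u  = ⊥-elim (u∉Rm (u∈𝕂[x_I] , μ∤u))
    ...   | yes μ∣u = ≈-trans (coeff-*ₚ-keepPart-fibre g u∈𝕂[x_I] v∈𝔐Ī)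
                              (pg∈⟨μ∤⟩ (u ·ₘ v) λ μ∤uv → μ∤uv λ i → ℕ.≤-trans (μ∣u i) (∣ₘ-·ₘ u v i))
    coeff≈0 : ∀ w → coeff (p *ₚ g) w ≈ 0#
    coeff≈0 w = begin
      coeff (p *ₚ g) w                          ≡⟨ cong (coeff (p *ₚ g)) (keep-·ₘ-delete I w) ⟨
      coeff (p *ₚ g) (keep I w ·ₘ delete I w)   ≈⟨ coeff-*ₚ-keepPart-fibre g (keep-supported I w) (delete-supported I w) ⟨
      coeff (p *ₚ B) (keep I w)                 ≈⟨ coeff-≈ (multiple-in-Rm⇒zero B (all⇒span B (all-keepPart _))
                                                                                 (pB∈⟨Rm⟩ (delete-supported I w))) _ ⟩
      0#                                        ∎
      where B = keepPart (fibre (delete I w) g)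

module DirectSum {c ℓ} (F : Field c ℓ) {n} {Σs : List (Subset n)} (Σ-unique : Unique Σs)
                 {m : Subset n → Mon n} (mf : MonotoneFamily n Σs m)
                 {p : Subset n → Polynomials.Poly F n}
                 (deformation : ∀ I → I ∈ Σs → Polynomials.IDeformation F n I (m I) (p I)) where
  open Field F renaming (refl to ≈-refl; sym to ≈-sym; trans to ≈-trans)
  open Polynomials F n
  open PolynomialAlgebra F n
  open MonotoneFamily mf
  open MonotoneFamilyProperties F mf

  ∑ : (Subset n → Poly) → Poly
  ∑ g = sumₚ (map (λ I → p I *ₚ g I) Σs)

  Decomposable : Poly → Set (c ⊔ ℓ)
  Decomposable f = ∃[ r ] Σ (Subset n → Poly) λ g →
    InSpan (InR Σs m) r × (∀ I → I ∈ Σs → InKR Σs m I (g I)) × f ≋ r ++ ∑ g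

  ∑-zero : ∑ (λ _ → []) ≋ []
  ∑-zero = mk≋ λ w → coeff-sumₚ-vanishing (λ I → p I *ₚ []) Σs w λ {J} _ → coeff-≈ (*ₚ-zeroʳ (p J)) w

  ∑-++ : ∀ g g′ → ∑ (λ I → g I ++ g′ I) ≋ ∑ g ++ ∑ g′
  ∑-++ g g′ = ≋-trans (sumₚ-cong _ _ Σs λ I → *ₚ-distribˡ (p I) (g I) (g′ I))
                      (sumₚ-++ (λ I → p I *ₚ g I) (λ I → p I *ₚ g′ I) Σs)

  at : Subset n → Poly → Subset n → Poly
  at I x J with Vec.≡-dec Bool._≟_ J I
  ... | yes _ = x
  ... | no _  = []

  ∑-at : ∀ {I} x → I ∈ Σs → ∑ (at I x) ≋ p I *ₚ x
  ∑-at {I} x I∈Σ = mk≋ λ w → ≈-trans (coeff-sumₚ-single (λ J → p J *ₚ at I x J) w Σ-unique I∈Σ (elsewhere w)) (at-I w)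
    where
    elsewhere : ∀ w {J} → J ∈ Σs → J ≢ I → coeff (p J *ₚ at I x J) w ≈ 0#
    elsewhere w {J} _ J≢I with Vec.≡-dec Bool._≟_ J I
    ... | yes J≡I = ⊥-elim (J≢I J≡I)
    ... | no _    = coeff-≈ (*ₚ-zeroʳ (p J)) w
    at-I : ∀ w → coeff (p I *ₚ at I x I) w ≈ coeff (p I *ₚ x) w
    at-I w with Vec.≡-dec Bool._≟_ I I
    ... | yes _   = ≈-refl
    ... | no I≢I = ⊥-elim (I≢I refl)

  at-summand : ∀ {I x} → InKR Σs m I x → ∀ J → InKR Σs m J (at I x J)
  at-summand {I} x∈KR J with Vec.≡-dec Bool._≟_ J I
  ... | yes refl = x∈KR
  ... | no _     = λ _ _ → ≈-refl

  decomposable-resp-≋ : ∀ {f f′} → f ≋ f′ → Decomposable f′ → Decomposable f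
  decomposable-resp-≋ f≋f′ (r , g , r∈⟨R⟩ , g∈KR , f′≋) = r , g , r∈⟨R⟩ , g∈KR , ≋-trans f≋f′ f′≋

  decomposable-summand : ∀ {I x} → I ∈ Σs → InKR Σs m I x → Decomposable (p I *ₚ x)
  decomposable-summand {I} {x} I∈Σ x∈KR =
    [] , at I x , (λ _ _ → ≈-refl) , (λ J _ → at-summand x∈KR J) , ≋-sym (∑-at x I∈Σ)

  decomposable-R : ∀ a {w} → InR Σs m w → Decomposable ((a , w) ∷ [])
  decomposable-R a {w} w∈R =
    (a , w) ∷ [] , (λ _ → []) , all⇒span ((a , w) ∷ []) (w∈R ∷ []) , (λ _ _ _ _ → ≈-refl) ,
    ≋-sym (≋-trans (++-cong (≋-refl {(a , w) ∷ []}) ∑-zero) (++-identityʳ _))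

  decomposable-++ : ∀ {f f′} → Decomposable f → Decomposable f′ → Decomposable (f ++ f′)
  decomposable-++ (r , g , r∈⟨R⟩ , g∈KR , f≋) (r′ , g′ , r′∈⟨R⟩ , g′∈KR , f′≋) =
    r ++ r′ , (λ I → g I ++ g′ I) , ++-span r r′ r∈⟨R⟩ r′∈⟨R⟩ ,
    (λ I I∈Σ → ++-span (g I) (g′ I) (g∈KR I I∈Σ) (g′∈KR I I∈Σ)) ,
    ≋-trans (++-cong f≋ f′≋) (≋-trans (++-interchange r (∑ g) r′ (∑ g′)) (++-cong ≋-refl (≋-sym (∑-++ g g′))))

  decomposable-all : ∀ {Q : Mon n → Set} → (∀ a {w} → Q w → Decomposable ((a , w) ∷ [])) →
                     ∀ f → All (Q ∘ proj₂) f → Decomposable f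
  decomposable-all _ [] [] = [] , (λ _ → []) , (λ _ _ → ≈-refl) , (λ _ _ _ _ → ≈-refl) , ≋-sym ∑-zero
  decomposable-all term ((a , w) ∷ f) (Qw ∷ Qf) = decomposable-++ (term a Qw) (decomposable-all term f Qf)

  NonMultiple : Subset n → Mon n → Set
  NonMultiple I u = SupportedIn I u × ¬ m I ∣ₘ u

  nonMultiple? : ∀ I → Decidable (NonMultiple I)
  nonMultiple? I u = supportedIn? I u ×-dec ¬? (m I ∣ₘ? u)

  -- Apply 𝕂[x_I] = ⟨R_{m_I}⟩ ⊕ (p_I) to the I-part of w and multiply back by its Ī-part.
  deformation-split : ∀ {I} → I ∈ Σs → ∀ a w → ∃[ r ] ∃[ q ]
    (All (NonMultiple I ∘ proj₂) r × All (SupportedIn I ∘ proj₂) q ×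
     (a , w) ∷ [] ≋ r *ₚ mono (delete I w) ++ p I *ₚ (q *ₚ mono (delete I w)))
  deformation-split {I} I∈Σ a w
    with IDeformation.spanning D ((a , keep I w) ∷ []) (all⇒span ((a , keep I w) ∷ []) (keep-supported I w ∷ []))
    where D = deformation I I∈Σ
  ... | r , q , r∈⟨Rm⟩ , q∈𝕂[x_I] , aw_I≈ =
    r′ , q′ , all-filter (nonMultiple? I ∘ proj₂) r , all-filter (supportedIn? I ∘ proj₂) q , (begin
      (a , w) ∷ []                                ≈⟨ keepPart-*ₚ-mono v ((a , w) ∷ []) (refl ∷ []) ⟨
      ((a , keep I w) ∷ []) *ₚ mono v              ≈⟨ *ₚ-congʳ (mono v) (mk≋ {(a , keep I w) ∷ []} {r ++ p I *ₚ q} aw_I≈) ⟩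
      (r ++ p I *ₚ q) *ₚ mono v                   ≈⟨ *ₚ-distribʳ r (p I *ₚ q) (mono v) ⟩
      r *ₚ mono v ++ (p I *ₚ q) *ₚ mono v         ≈⟨ ++-cong (*ₚ-congʳ (mono v) (restrict-≋ (nonMultiple? I) r r∈⟨Rm⟩))
                                                           (≋-sym (*ₚ-assoc (p I) q (mono v))) ⟨
      r′ *ₚ mono v ++ p I *ₚ (q *ₚ mono v)        ≈⟨ ++-cong ≋-refl (*ₚ-congˡ (p I) (*ₚ-congʳ (mono v)
                                                                    (restrict-≋ (supportedIn? I) q q∈𝕂[x_I]))) ⟨
      r′ *ₚ mono v ++ p I *ₚ (q′ *ₚ mono v)       ∎)
    where
    open ≋-Reasoning
    open DeformationProperties F (deformation I I∈Σ) using (keepPart-*ₚ-mono)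
    v = delete I w
    r′ = restrict (nonMultiple? I) r
    q′ = restrict (supportedIn? I) q

  remainder-below : ∀ {I w u} → I ∈ Σs → Based I w → NonMultiple I u →
                    InR Σs m (u ·ₘ delete I w) ⊎ ∃[ J ] (J ∈ Σs × J ⊂ I × Based J (u ·ₘ delete I w))
  remainder-below {I} {w} {u} I∈Σ w-based (u∈𝕂[x_I] , mI∤u) with R⊎leading (u ·ₘ delete I w)
  ... | inj₁ uv∈R = inj₁ uv∈R
  ... | inj₂ (J , J∈Σ , J-leading) =
    inj₂ (J , J∈Σ , leading-below-based I∈Σ J∈Σ (mI∤u ∘ ∣ₘ-·ₘ-delete⇒∣ₘ {m = m I} u w (MM1 I∈Σ))
                                        (based-·ₘ u u∈𝕂[x_I] (InRI⇒based w-based)) J-leading ,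
          proj₂ J-leading)

  decomposable-based : ∀ I → I ∈ Σs → ∀ a {w} → Based I w → Decomposable ((a , w) ∷ [])
  decomposable-based = WF.All.wfRec ⊂-wellFounded (c ⊔ ℓ) _ step
    where
    step : ∀ I → (∀ {J} → J ⊂ I → J ∈ Σs → ∀ a {w} → Based J w → Decomposable ((a , w) ∷ [])) →
           I ∈ Σs → ∀ a {w} → Based I w → Decomposable ((a , w) ∷ [])
    step I below I∈Σ a {w} w-based with deformation-split I∈Σ a w
    ... | r , q , r-nonmultiple , q∈𝕂[x_I] , aw≋ =
      decomposable-resp-≋ aw≋ (decomposable-++
        (decomposable-all remainder-term (r *ₚ mono v)
                          (all-*ₚ-mono v r r-nonmultiple λ _ → remainder-below I∈Σ w-based))
        (decomposable-summand I∈Σ (all⇒span (q *ₚ mono v)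
                                   (all-*ₚ-mono v q q∈𝕂[x_I] λ u u∈𝕂[x_I] → u , v , u∈𝕂[x_I] , w-based , refl))))
      where
      v = delete I w
      remainder-term : ∀ b {y} → InR Σs m y ⊎ ∃[ J ] (J ∈ Σs × J ⊂ I × Based J y) → Decomposable ((b , y) ∷ [])
      remainder-term b (inj₁ y∈R) = decomposable-R b y∈R
      remainder-term b (inj₂ (J , J∈Σ , J⊂I , y-based)) = below J⊂I J∈Σ b y-based

  decomposable : ∀ f → Decomposable f
  decomposable f = decomposable-all term f (All.universal (R⊎leading ∘ proj₂) f)
    where
    term : ∀ a {w} → InR Σs m w ⊎ ∃[ I ] (I ∈ Σs × Leading I w) → Decomposable ((a , w) ∷ [])
    term a (inj₁ w∈R) = decomposable-R a w∈R
    term a (inj₂ (I , I∈Σ , _ , w-based)) = decomposable-based I I∈Σ a w-based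

  summand-based : ∀ {I h} → I ∈ Σs → InKR Σs m I h → InSpan (Based I) (p I *ₚ h)
  summand-based {I} {h} I∈Σ h∈KR =
    span-resp-≋ (≋-trans (*ₚ-congʳ h (≋-sym p′≋p)) (*ₚ-congˡ p′ (≋-sym (restrict-≋ (based? I) h h∈⟨Based⟩))))
      (*ₚ-span (λ u _ → based-·ₘ u)
               p′ (restrict (based? I) h)
               (all-filter (supportedIn? I ∘ proj₂) (p I)) (all-filter (based? I ∘ proj₂) h))
    where
    open DeformationProperties F (deformation I I∈Σ) using (p′; p′≋p)
    h∈⟨Based⟩ : InSpan (Based I) h
    h∈⟨Based⟩ w ¬based = h∈KR w λ (u , v , u∈𝕂[x_I] , v∈RI , w≡uv) →
      ¬based (subst (Based I) (≡.sym w≡uv) (based-·ₘ u u∈𝕂[x_I] (InRI⇒based v∈RI)))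

  module Independence {r g} (r∈⟨R⟩ : InSpan (InR Σs m) r) (g∈KR : ∀ I → I ∈ Σs → InKR Σs m I (g I))
                      (sum≈0 : r +ₚ ∑ g ≈ₚ 0ₚ) where
    open ≈-Reasoning

    summand-zero : ∀ I → (∀ {J} → I ⊂ J → J ∈ Σs → p J *ₚ g J ≋ []) → I ∈ Σs → p I *ₚ g I ≋ []
    summand-zero I above I∈Σ = multiple-without-μ⇒zero (g I) no-multiples
      where
      open DeformationProperties F (deformation I I∈Σ) using (multiple-without-μ⇒zero)
      at-leading : ∀ {w} → Leading I w → coeff (p I *ₚ g I) w ≈ 0#
      at-leading {w} w-leading = begin
        coeff (p I *ₚ g I) w       ≈⟨ coeff-sumₚ-single (λ J → p J *ₚ g J) w Σ-unique I∈Σ others ⟨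
        coeff (∑ g) w              ≈⟨ +-identityˡ _ ⟨
        0# + coeff (∑ g) w         ≈⟨ +-cong (r∈⟨R⟩ w λ w∈R → w∈R I I∈Σ (proj₁ w-leading)) ≈-refl ⟨
        coeff r w + coeff (∑ g) w  ≈⟨ coeff-++ r (∑ g) w ⟨
        coeff (r ++ ∑ g) w         ≈⟨ sum≈0 w ⟩
        0#                         ∎
        where
        others : ∀ {J} → J ∈ Σs → J ≢ I → coeff (p J *ₚ g J) w ≈ 0#
        others {J} J∈Σ J≢I with I ⊂? J
        ... | yes I⊂J = coeff-≈ (above I⊂J J∈Σ) w
        ... | no I⊄J  = summand-based J∈Σ (g∈KR J J∈Σ) w λ w-J-based →
                          [ J≢I ∘ ≡.sym , I⊄J ]′ (leading⇒⊆-based I∈Σ J∈Σ w-J-based w-leading)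
      no-multiples : InSpan (λ y → ¬ m I ∣ₘ y) (p I *ₚ g I)
      no-multiples w ¬¬mI∣w with based? I w | m I ∣ₘ? w
      ... | no w-unbased | _       = summand-based I∈Σ (g∈KR I I∈Σ) w w-unbased
      ... | yes w-based  | yes mI∣w = at-leading (mI∣w , w-based)
      ... | yes _        | no mI∤w  = ⊥-elim (¬¬mI∣w mI∤w)

    summands-zero : ∀ I → I ∈ Σs → p I *ₚ g I ≋ []
    summands-zero = WF.All.wfRec ⊃-wellFounded ℓ _ summand-zero

    remainder-zero : r ≋ []
    remainder-zero = mk≋ λ w → begin
      coeff r w                   ≈⟨ +-identityʳ _ ⟨
      coeff r w + 0#              ≈⟨ +-cong ≈-refl (coeff-sumₚ-vanishing (λ J → p J *ₚ g J) Σs w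
                                                     λ {J} J∈Σ → coeff-≈ (summands-zero J J∈Σ) w) ⟨
      coeff r w + coeff (∑ g) w   ≈⟨ coeff-++ r (∑ g) w ⟨
      coeff (r ++ ∑ g) w          ≈⟨ sum≈0 w ⟩
      0#                          ∎

proposition10p3 : ∀ {c ℓ} (F : Field c ℓ) (n : ℕ)
    (Σs : List (Subset n)) → Unique Σs → All Nonempty Σs →
    (m : Subset n → Mon n) → MonotoneFamily n Σs m →
    let open Polynomials F n in
    (p : Subset n → Poly) → (∀ I → I ∈ Σs → IDeformation I (m I) (p I)) →
    -- every polynomial decomposes ...
    (∀ f → ∃[ r ] Σ (Subset n → Poly) λ g →
       InSpan (InR Σs m) r × (∀ I → I ∈ Σs → InKR Σs m I (g I)) ×
       f ≈ₚ r +ₚ sumₚ (map (λ I → p I *ₚ g I) Σs))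
    -- ... and the sum is direct
    × (∀ r (g : Subset n → Poly) →
       InSpan (InR Σs m) r → (∀ I → I ∈ Σs → InKR Σs m I (g I)) →
       r +ₚ sumₚ (map (λ I → p I *ₚ g I) Σs) ≈ₚ 0ₚ →
       r ≈ₚ 0ₚ × (∀ I → I ∈ Σs → p I *ₚ g I ≈ₚ 0ₚ))
-- The argument never uses that the members of Σ are nonempty.
proposition10p3 F n Σs Σ-unique _ m mf p deformation =
  (λ f → let r , g , r∈⟨R⟩ , g∈KR , f≋ = decomposable f in r , g , r∈⟨R⟩ , g∈KR , coeff-≈ f≋) ,
  (λ r g r∈⟨R⟩ g∈KR sum≈0 → let open Independence {r} {g} r∈⟨R⟩ g∈KR sum≈0 in
     coeff-≈ remainder-zero , λ I I∈Σ → coeff-≈ (summands-zero I I∈Σ))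
  where
  open DirectSum F Σ-unique mf deformation
  open PolynomialAlgebra F n using (coeff-≈)
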